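{- Let $2\le n_1<n_2<\cdots<n_m$ be integers, $t_1,\dots,t_m$ positive integers, $\overline{t}_k=\sum_{i=1}^k t_i$, and $G=K_{n_1}^{t_1}\square\cdots\square K_{n_m}^{t_m}$. If $\overline{t}_k\ge 1+\frac{n_k(n_k^2-1)}{6}$ for some $k\in\{1,\dots,m\}$, then $G$ is not radio graceful.
   Context: $K_n$ is the complete graph on $n$ vertices; $\square$ is the Cartesian product of graphs ($(a,b)\sim(a',b')$ iff $a=a'$ and $b\sim b'$, or $b=b'$ and $a\sim a'$) and $H^s$ is the Cartesian product of $s$ copies of $H$. A radio labeling of a connected graph $H$ is $f:V(H)\to\mathbb{Z}^+$ with $|f(u)-f(v)|\ge\mathrm{diam}(H)+1-d(u,v)$ for all distinct $u,v$. $H$ is radio graceful if it has a radio labeling that is a bijection onto $\{1,\dots,|V(H)|\}$. -}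

module Defs where

open import Data.Nat using (ℕ; zero; suc; _+_; _*_; _^_; _≤_; ∣_-_∣)
open import Data.Fin using (Fin; zero; suc; toℕ; remQuot)
open import Data.Product using (Σ; ∃; _×_; _,_; proj₁; proj₂)
open import Data.Sum using (_⊎_)
open import Relation.Binary.PropositionalEquality using (_≡_; _≢_)
open import Function using (_∘_)
open import Function.Definitions using (Bijective)

-- A (simple, undirected in all uses below) graph on the vertex set Fin N,
-- given by its adjacency relation.
Graph : ℕ → Set₁
Graph N = Fin N → Fin N → Set

K : (n : ℕ) → Graph n
K n i j = i ≢ j

-- Cartesian product H₁ □ H₂ on Fin (a * b); vertex x ∈ Fin (a * b)
-- corresponds to the pair remQuot b x ∈ Fin a × Fin b.
_□_ : ∀ {a b} → Graph a → Graph b → Graph (a * b)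
_□_ {a} {b} H₁ H₂ x y with remQuot {a} b x | remQuot {a} b y
... | (p , q) | (p' , q') = (p ≡ p' × H₂ q q') ⊎ (q ≡ q' × H₁ p p')

pow : ∀ {n} → Graph n → (s : ℕ) → Graph (n ^ s)
pow H zero = K 1
pow H (suc s) = H □ pow H s

order : (m : ℕ) → (Fin m → ℕ) → (Fin m → ℕ) → ℕ
order zero ns ts = 1
order (suc m) ns ts = (ns zero ^ ts zero) * order m (ns ∘ suc) (ts ∘ suc)

prodG : (m : ℕ) (ns ts : Fin m → ℕ) → Graph (order m ns ts)
prodG zero ns ts = K 1
prodG (suc m) ns ts = pow (K (ns zero)) (ts zero) □ prodG m (ns ∘ suc) (ts ∘ suc)

-- Prefix sums: psum t k = t_1 + ⋯ + t_k (k is 0-based here).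
psum : ∀ {m} → (Fin m → ℕ) → Fin m → ℕ
psum t zero = t zero
psum t (suc k) = t zero + psum (t ∘ suc) k

data Walk {N} (G : Graph N) : Fin N → Fin N → ℕ → Set where
  here : ∀ {u} → Walk G u u zero
  step : ∀ {u w v k} → G u w → Walk G w v k → Walk G u v (suc k)

IsDist : ∀ {N} → Graph N → Fin N → Fin N → ℕ → Set
IsDist G u v k = Walk G u v k × (∀ j → Walk G u v j → k ≤ j)

IsDiam : ∀ {N} → Graph N → ℕ → Set
IsDiam G D = (∀ u v k → IsDist G u v k → k ≤ D)
           × Σ _ λ u → Σ _ λ v → IsDist G u v D

-- Radio labeling f : V → ℤ⁺ with |f u - f v| ≥ diam + 1 - d(u,v) for u ≠ v
-- (stated without truncated subtraction: diam + 1 ≤ |f u - f v| + d(u,v)).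
RadioLabeling : ∀ {N} → Graph N → (Fin N → ℕ) → Set
RadioLabeling G f =
  (∀ v → 1 ≤ f v) ×
  (∀ D → IsDiam G D → ∀ u v → u ≢ v → ∀ k → IsDist G u v k →
     D + 1 ≤ ∣ f u - f v ∣ + k)

-- Radio graceful: a radio labeling that is a bijection onto {1,…,N};
-- such a labeling is v ↦ 1 + toℕ (g v) for a bijection g : Fin N → Fin N.
RadioGraceful : ∀ {N} → Graph N → Set
RadioGraceful {N} G =
  Σ (Fin N → Fin N) λ g → Bijective _≡_ _≡_ g × RadioLabeling G (suc ∘ toℕ ∘ g)

-- In G every K_n-coordinate has diameter 1, so d(u,v) is the number of
-- coordinates in which u and v differ and diam G = D = t̄_m.  Put P = n_k and
-- let x_0, …, x_P be the vertices with labels 1, …, P+1 under a radio graceful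
-- labeling.  The radio condition for x_a, x_b (a < b) says that they agree in
-- at most b − a − 1 coordinates, so summed over all pairs there are at most
-- Σ_{a<b≤P} (b − a − 1) = P(P²−1)/6 agreements.  On the other hand each of the
-- first t̄_k coordinates ranges over at most P values, so by pigeonhole two of
-- the P+1 vertices agree there, giving at least t̄_k agreements.
module Submission where

open import Defs
open import Data.Nat using (ℕ; _+_; _*_; _∸_; _≤_; _<_)
open import Data.Fin using (Fin)
open import Data.Product using (∃)
open import Relation.Nullary using (¬_)

open import Data.Empty using (⊥-elim)
open import Data.Fin as Fin using (zero; suc; toℕ; remQuot; combine)
open import Data.Fin.Properties
  using (remQuot-combine; combine-remQuot; pigeonhole; toℕ<n; toℕ-fromℕ<; toℕ-injective)
open import Data.Nat as ℕ using (zero; suc; _^_; z≤n; s≤s; s≤s⁻¹; z<s; NonZero; >-nonZero; ∣_-_∣)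
open import Data.Nat.DivMod using (_%_; _mod_; m<n⇒m%n≡m)
open import Data.Nat.Properties
open import Data.Nat.Tactic.RingSolver using (solve-∀)
open import Algebra.Properties.CommutativeSemigroup +-commutativeSemigroup
  using (interchange)
open import Data.Product using (∃₂; _×_; _,_; proj₁; proj₂)
open import Data.Sum using (inj₁; inj₂)
open import Function using (_∘_)
open import Relation.Nullary using (yes; no)
open import Relation.Binary.PropositionalEquality

sumBelow : ℕ → (ℕ → ℕ) → ℕ
sumBelow zero    f = 0
sumBelow (suc m) f = sumBelow m f + f m

-- Σ_{a < b < m} h a b, peeling off the pairs with a = 0.
pairSum : ℕ → (ℕ → ℕ → ℕ) → ℕ
pairSum zero    h = 0
pairSum (suc m) h = sumBelow m (h 0 ∘ suc) + pairSum m (λ a b → h (suc a) (suc b))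

sumBelow-+ : ∀ m (f g : ℕ → ℕ) →
             sumBelow m (λ b → f b + g b) ≡ sumBelow m f + sumBelow m g
sumBelow-+ zero    f g = refl
sumBelow-+ (suc m) f g =
  trans (cong (_+ (f m + g m)) (sumBelow-+ m f g)) (interchange (sumBelow m f) (sumBelow m g) (f m) (g m))

pairSum-+ : ∀ m (h₁ h₂ : ℕ → ℕ → ℕ) →
            pairSum m (λ a b → h₁ a b + h₂ a b) ≡ pairSum m h₁ + pairSum m h₂
pairSum-+ zero    h₁ h₂ = refl
pairSum-+ (suc m) h₁ h₂ =
  trans (cong₂ _+_ (sumBelow-+ m (h₁ 0 ∘ suc) (h₂ 0 ∘ suc))
                   (pairSum-+ m (λ a b → h₁ (suc a) (suc b)) (λ a b → h₂ (suc a) (suc b))))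
        (interchange (sumBelow m (h₁ 0 ∘ suc)) (sumBelow m (h₂ 0 ∘ suc)) _ _)

sumBelow-mono : ∀ m {f g : ℕ → ℕ} → (∀ b → b < m → f b ≤ g b) →
                sumBelow m f ≤ sumBelow m g
sumBelow-mono zero    f≤g = z≤n
sumBelow-mono (suc m) f≤g =
  +-mono-≤ (sumBelow-mono m (λ b b<m → f≤g b (m<n⇒m<1+n b<m))) (f≤g m ≤-refl)

pairSum-mono : ∀ m {h₁ h₂ : ℕ → ℕ → ℕ} → (∀ a b → a < b → b < m → h₁ a b ≤ h₂ a b) →
               pairSum m h₁ ≤ pairSum m h₂
pairSum-mono zero    h₁≤h₂ = z≤n
pairSum-mono (suc m) h₁≤h₂ =
  +-mono-≤ (sumBelow-mono m (λ b b<m → h₁≤h₂ 0 (suc b) z<s (s≤s b<m)))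
           (pairSum-mono m (λ a b a<b b<m → h₁≤h₂ (suc a) (suc b) (s≤s a<b) (s≤s b<m)))

term≤sumBelow : ∀ m (f : ℕ → ℕ) {b} → b < m → f b ≤ sumBelow m f
term≤sumBelow (suc m) f (s≤s b≤m) with m≤n⇒m<n∨m≡n b≤m
... | inj₁ b<m  = ≤-trans (term≤sumBelow m f b<m) (m≤m+n _ _)
... | inj₂ refl = m≤n+m _ _

term≤pairSum : ∀ m (h : ℕ → ℕ → ℕ) {a b} → a < b → b < m → h a b ≤ pairSum m h
term≤pairSum (suc m) h {zero}  {suc b} a<b       (s≤s b<m) =
  ≤-trans (term≤sumBelow m (h 0 ∘ suc) b<m) (m≤m+n _ _)
term≤pairSum (suc m) h {suc a} {suc b} (s≤s a<b) (s≤s b<m) =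
  ≤-trans (term≤pairSum m (λ a b → h (suc a) (suc b)) a<b b<m) (m≤n+m _ _)

gap : ℕ → ℕ → ℕ
gap a b = b ∸ suc a

2*sumBelow-id+m≡m*m : ∀ m → 2 * sumBelow m (λ b → b) + m ≡ m * m
2*sumBelow-id+m≡m*m zero    = refl
2*sumBelow-id+m≡m*m (suc m) = begin
  2 * (R + m) + suc m        ≡⟨ regroup R m ⟩
  (2 * R + m) + (2 * m + 1)  ≡⟨ cong (_+ (2 * m + 1)) (2*sumBelow-id+m≡m*m m) ⟩
  m * m + (2 * m + 1)        ≡⟨ square m ⟩
  suc m * suc m              ∎
  where
  open ≡-Reasoning
  R = sumBelow m (λ b → b)
  regroup : ∀ R m → 2 * (R + m) + suc m ≡ (2 * R + m) + (2 * m + 1)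
  regroup = solve-∀
  square : ∀ m → m * m + (2 * m + 1) ≡ suc m * suc m
  square = solve-∀

-- Summing over pairs below m + 1 makes gap 0 (suc b) = b and
-- gap (suc a) (suc b) = gap a b, so the recursion of pairSum closes up.
6*pairSum-gap+m≡m³ : ∀ m → 6 * pairSum (suc m) gap + m ≡ m * m * m
6*pairSum-gap+m≡m³ zero    = refl
6*pairSum-gap+m≡m³ (suc m) = +-cancelʳ-≡ (2 + 3 * m) _ _ (begin
  6 * (R + Q) + suc m + (2 + 3 * m)    ≡⟨ regroup R Q m ⟩
  3 * (2 * R + suc m) + (6 * Q + m)    ≡⟨ cong₂ (λ x y → 3 * x + y)
                                                (2*sumBelow-id+m≡m*m (suc m))
                                                (6*pairSum-gap+m≡m³ m) ⟩
  3 * (suc m * suc m) + m * m * m      ≡⟨ cube m ⟩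
  suc m * suc m * suc m + (2 + 3 * m)  ∎)
  where
  open ≡-Reasoning
  R = sumBelow (suc m) (λ b → b)
  Q = pairSum (suc m) gap
  regroup : ∀ R Q m → 6 * (R + Q) + suc m + (2 + 3 * m) ≡ 3 * (2 * R + suc m) + (6 * Q + m)
  regroup = solve-∀
  cube : ∀ m → 3 * (suc m * suc m) + m * m * m ≡ suc m * suc m * suc m + (2 + 3 * m)
  cube = solve-∀

6*pairSum-gap : ∀ m → 6 * pairSum (suc m) gap ≡ m * (m * m ∸ 1)
6*pairSum-gap m = +-cancelʳ-≡ m _ _ (trans (6*pairSum-gap+m≡m³ m) (sym (cube m)))
  where
  cube : ∀ m → m * (m * m ∸ 1) + m ≡ m * m * m
  cube zero    = refl
  cube (suc m) = expand m
    where
    expand : ∀ m → suc m * (m + m * suc m) + suc m ≡ suc m * suc m * suc m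
    expand = solve-∀

record Metric {N} (G : Graph N) : Set where
  field
    dist         : Fin N → Fin N → ℕ
    dist-self    : ∀ u → dist u u ≡ 0
    dist≡0⇒≡     : ∀ {u v} → dist u v ≡ 0 → u ≡ v
    dist-edge    : ∀ {u x} v → G u x → dist u v ≤ suc (dist x v)
    dist-descent : ∀ {u v k} → dist u v ≡ suc k → ∃ λ x → G u x × dist x v ≡ k
    diam         : ℕ
    dist≤diam    : ∀ u v → dist u v ≤ diam
    antipodal    : ∃₂ λ u v → dist u v ≡ diam

  dist≤length : ∀ {u v j} → Walk G u v j → dist u v ≤ j
  dist≤length {u}     here       = ≤-reflexive (dist-self u)
  dist≤length {v = v} (step e w) = ≤-trans (dist-edge v e) (s≤s (dist≤length w))

  geodesic : ∀ k {u v} → dist u v ≡ k → Walk G u v k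
  geodesic zero    {u} d≡0 = subst (λ v → Walk G u v 0) (dist≡0⇒≡ d≡0) here
  geodesic (suc k) d≡k+1 with dist-descent d≡k+1
  ... | x , e , d≡k = step e (geodesic k d≡k)

  isDist : ∀ u v → IsDist G u v (dist u v)
  isDist u v = geodesic _ refl , λ j → dist≤length

  isDiam : IsDiam G diam
  isDiam = (λ u v k d → ≤-trans (proj₂ d (dist u v) (geodesic _ refl)) (dist≤diam u v))
         , attained antipodal
    where
    attained : (∃₂ λ u v → dist u v ≡ diam) → ∃₂ λ u v → IsDist G u v diam
    attained (u , v , d≡diam) = u , v , subst (IsDist G u v) d≡diam (isDist u v)

open Metric

deficiency : ∀ {N} {G : Graph N} → Metric G → Fin N → Fin N → ℕ
deficiency M u v = diam M ∸ dist M u v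

-- In a Hamming-type metric the deficiency counts the coordinates in which
-- u and v agree; Spread P M t says that any P + 1 vertices (repetitions
-- allowed) have at least t such agreements in total.
Spread : ∀ {N} {G : Graph N} → ℕ → Metric G → ℕ → Set
Spread {N} P M t = (xs : ℕ → Fin N) →
  t ≤ pairSum (suc P) (λ a b → deficiency M (xs a) (xs b))

spread-zero : ∀ {N} {G : Graph N} P (M : Metric G) → Spread P M 0
spread-zero P M xs = z≤n

metric-K1 : Metric (K 1)
metric-K1 = record
  { dist = λ _ _ → 0 ; dist-self = λ _ → refl ; dist≡0⇒≡ = λ { {zero} {zero} _ → refl }
  ; dist-edge = λ _ _ → z≤n ; dist-descent = λ () ; diam = 0
  ; dist≤diam = λ _ _ → z≤n ; antipodal = zero , zero , refl }

module _ {n : ℕ} where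

  distK : Fin n → Fin n → ℕ
  distK u v with u Fin.≟ v
  ... | yes _ = 0
  ... | no  _ = 1

  distK-self : ∀ u → distK u u ≡ 0
  distK-self u with u Fin.≟ u
  ... | yes _   = refl
  ... | no  u≢u = ⊥-elim (u≢u refl)

  distK≤1 : ∀ u v → distK u v ≤ 1
  distK≤1 u v with u Fin.≟ v
  ... | yes _ = z≤n
  ... | no  _ = s≤s z≤n

  distK≡0⇒≡ : ∀ {u v} → distK u v ≡ 0 → u ≡ v
  distK≡0⇒≡ {u} {v} d≡0 with u Fin.≟ v
  ... | yes u≡v = u≡v

  distK-descent : ∀ {u v k} → distK u v ≡ suc k → ∃ λ x → K n u x × distK x v ≡ k
  distK-descent {u} {v} {k} d≡k+1 with u Fin.≟ v
  distK-descent {u} {v} {zero} refl | no u≢v = v , u≢v , distK-self v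

metric-K : ∀ {n} → 2 ≤ n → Metric (K n)
metric-K n≥2 = record
  { dist = distK ; dist-self = distK-self ; dist≡0⇒≡ = distK≡0⇒≡
  ; dist-edge = λ {u} v _ → ≤-trans (distK≤1 u v) (s≤s z≤n)
  ; dist-descent = distK-descent ; diam = 1
  ; dist≤diam = distK≤1 ; antipodal = antipodal-K n≥2 }
  where
  antipodal-K : ∀ {n} → 2 ≤ n → ∃₂ λ (u v : Fin n) → distK u v ≡ 1
  antipodal-K (s≤s (s≤s z≤n)) = zero , suc zero , refl

spread-K : ∀ {n P} (n≥2 : 2 ≤ n) → n ≤ P → Spread P (metric-K n≥2) 1
spread-K {P = P} n≥2 n≤P xs with pigeonhole (s≤s n≤P) (xs ∘ toℕ)
... | i , j , i<j , xsᵢ≡xsⱼ =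
  ≤-trans 1≤deficiency (term≤pairSum (suc P) (λ a b → 1 ∸ distK (xs a) (xs b)) i<j (toℕ<n j))
  where
  1≤deficiency : 1 ≤ 1 ∸ distK (xs (toℕ i)) (xs (toℕ j))
  1≤deficiency rewrite xsᵢ≡xsⱼ | distK-self (xs (toℕ j)) = ≤-refl

[a+b]∸[c+d]≡[a∸c]+[b∸d] : ∀ {a b c d} → c ≤ a → d ≤ b → (a + b) ∸ (c + d) ≡ (a ∸ c) + (b ∸ d)
[a+b]∸[c+d]≡[a∸c]+[b∸d] {a} {b} {c} {d} c≤a d≤b = begin
  (a + b) ∸ (c + d)    ≡⟨ ∸-+-assoc (a + b) c d ⟨
  (a + b) ∸ c ∸ d      ≡⟨ cong (_∸ d) (+-∸-comm b c≤a) ⟩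
  (a ∸ c) + b ∸ d      ≡⟨ +-∸-assoc (a ∸ c) d≤b ⟩
  (a ∸ c) + (b ∸ d)    ∎
  where open ≡-Reasoning

module _ {a b} {H₁ : Graph a} {H₂ : Graph b} (M₁ : Metric H₁) (M₂ : Metric H₂) where

  private
    fst : Fin (a * b) → Fin a
    fst x = proj₁ (remQuot {a} b x)

    snd : Fin (a * b) → Fin b
    snd x = proj₂ (remQuot {a} b x)

    fst-combine : ∀ (i : Fin a) (j : Fin b) → fst (combine i j) ≡ i
    fst-combine i j = cong proj₁ (remQuot-combine i j)

    snd-combine : ∀ (i : Fin a) (j : Fin b) → snd (combine i j) ≡ j
    snd-combine i j = cong proj₂ (remQuot-combine i j)

    d₁ d₂ d : Fin (a * b) → Fin (a * b) → ℕ
    d₁ x y = dist M₁ (fst x) (fst y)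
    d₂ x y = dist M₂ (snd x) (snd y)
    d  x y = d₁ x y + d₂ x y

    d-combine : ∀ (i : Fin a) (j : Fin b) v → d (combine i j) v ≡ dist M₁ i (fst v) + dist M₂ j (snd v)
    d-combine i j v = cong₂ (λ i′ j′ → dist M₁ i′ (fst v) + dist M₂ j′ (snd v))
                            (fst-combine i j) (snd-combine i j)

    edge : ∀ {u x} v → (H₁ □ H₂) u x → d u v ≤ suc (d x v)
    edge {u} {x} v (inj₁ (fst≡ , e)) = begin
      d₁ u v + d₂ u v        ≡⟨ cong (λ i → dist M₁ i (fst v) + d₂ u v) fst≡ ⟩
      d₁ x v + d₂ u v        ≤⟨ +-monoʳ-≤ (d₁ x v) (dist-edge M₂ (snd v) e) ⟩
      d₁ x v + suc (d₂ x v)  ≡⟨ +-suc (d₁ x v) (d₂ x v) ⟩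
      suc (d x v)            ∎
      where open ≤-Reasoning
    edge {u} {x} v (inj₂ (snd≡ , e)) = begin
      d₁ u v + d₂ u v  ≡⟨ cong (λ j → d₁ u v + dist M₂ j (snd v)) snd≡ ⟩
      d₁ u v + d₂ x v  ≤⟨ +-monoˡ-≤ (d₂ x v) (dist-edge M₁ (fst v) e) ⟩
      suc (d x v)      ∎
      where open ≤-Reasoning

    -- Walk towards v in the first coordinate while it still differs.
    descent : ∀ {u v k} → d u v ≡ suc k → ∃ λ x → (H₁ □ H₂) u x × d x v ≡ k
    descent {u} {v} {k} d≡k+1 with d₁ u v in d₁≡
    ... | zero with dist-descent M₂ d≡k+1
    ...   | j , e , d₂≡k = combine (fst u) j
                         , inj₁ (sym (fst-combine (fst u) j) , subst (H₂ (snd u)) (sym (snd-combine (fst u) j)) e)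
                         , trans (d-combine (fst u) j v) (cong₂ _+_ d₁≡ d₂≡k)
    descent {u} {v} {k} d≡k+1 | suc k₁ with dist-descent M₁ d₁≡
    ...   | i , e , d₁≡k₁ = combine i (snd u)
                          , inj₂ (sym (snd-combine i (snd u)) , subst (H₁ (fst u)) (sym (fst-combine i (snd u))) e)
                          , trans (d-combine i (snd u) v) (trans (cong (_+ d₂ u v) d₁≡k₁) (suc-injective d≡k+1))

    d≡0⇒≡ : ∀ {u v} → d u v ≡ 0 → u ≡ v
    d≡0⇒≡ {u} {v} d≡0 = begin
      u                            ≡⟨ combine-remQuot {a} b u ⟨
      combine (fst u) (snd u)      ≡⟨ cong₂ combine (dist≡0⇒≡ M₁ (m+n≡0⇒m≡0 _ d≡0))
                                                    (dist≡0⇒≡ M₂ (m+n≡0⇒n≡0 (d₁ u v) d≡0)) ⟩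
      combine (fst v) (snd v)      ≡⟨ combine-remQuot {a} b v ⟩
      v                            ∎
      where open ≡-Reasoning

  infixr 7 _□ᴹ_
  _□ᴹ_ : Metric (H₁ □ H₂)
  _□ᴹ_ = record
    { dist = d
    ; dist-self = λ u → cong₂ _+_ (dist-self M₁ (fst u)) (dist-self M₂ (snd u))
    ; dist≡0⇒≡ = d≡0⇒≡
    ; dist-edge = edge
    ; dist-descent = descent
    ; diam = diam M₁ + diam M₂
    ; dist≤diam = λ u v → +-mono-≤ (dist≤diam M₁ (fst u) (fst v)) (dist≤diam M₂ (snd u) (snd v))
    ; antipodal = antipodal′ (antipodal M₁) (antipodal M₂) }
    where
    antipodal′ : (∃₂ λ u v → dist M₁ u v ≡ diam M₁) → (∃₂ λ u v → dist M₂ u v ≡ diam M₂) →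
                 ∃₂ λ u v → d u v ≡ diam M₁ + diam M₂
    antipodal′ (u₁ , v₁ , d₁≡) (u₂ , v₂ , d₂≡) =
      combine u₁ u₂ , combine v₁ v₂ ,
      trans (d-combine u₁ u₂ (combine v₁ v₂))
            (cong₂ _+_ (trans (cong (dist M₁ u₁) (fst-combine v₁ v₂)) d₁≡)
                       (trans (cong (dist M₂ u₂) (snd-combine v₁ v₂)) d₂≡))

  spread-□ : ∀ {P t₁ t₂} → Spread P M₁ t₁ → Spread P M₂ t₂ → Spread P _□ᴹ_ (t₁ + t₂)
  spread-□ {P} {t₁} {t₂} spread₁ spread₂ xs = begin
    t₁ + t₂                                    ≤⟨ +-mono-≤ (spread₁ (fst ∘ xs)) (spread₂ (snd ∘ xs)) ⟩
    pairSum (suc P) h₁ + pairSum (suc P) h₂    ≡⟨ pairSum-+ (suc P) h₁ h₂ ⟨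
    pairSum (suc P) (λ i j → h₁ i j + h₂ i j)  ≤⟨ pairSum-mono (suc P) (λ i j _ _ → ≤-reflexive (sym (additive (xs i) (xs j)))) ⟩
    pairSum (suc P) (λ i j → deficiency _□ᴹ_ (xs i) (xs j)) ∎
    where
    open ≤-Reasoning
    h₁ h₂ : ℕ → ℕ → ℕ
    h₁ i j = deficiency M₁ (fst (xs i)) (fst (xs j))
    h₂ i j = deficiency M₂ (snd (xs i)) (snd (xs j))
    additive : ∀ x y → deficiency _□ᴹ_ x y ≡ deficiency M₁ (fst x) (fst y) + deficiency M₂ (snd x) (snd y)
    additive x y = [a+b]∸[c+d]≡[a∸c]+[b∸d] (dist≤diam M₁ (fst x) (fst y)) (dist≤diam M₂ (snd x) (snd y))

metric-pow : ∀ {n} → 2 ≤ n → ∀ t → Metric (pow (K n) t)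
metric-pow n≥2 zero    = metric-K1
metric-pow n≥2 (suc t) = metric-K n≥2 □ᴹ metric-pow n≥2 t

metric-prodG : ∀ m (ns ts : Fin m → ℕ) → (∀ i → 2 ≤ ns i) → Metric (prodG m ns ts)
metric-prodG zero    ns ts ns≥2 = metric-K1
metric-prodG (suc m) ns ts ns≥2 =
  metric-pow (ns≥2 zero) (ts zero) □ᴹ metric-prodG m (ns ∘ suc) (ts ∘ suc) (ns≥2 ∘ suc)


spread-pow : ∀ {n P} (n≥2 : 2 ≤ n) → n ≤ P → ∀ t → Spread P (metric-pow n≥2 t) t
spread-pow {P = P} n≥2 n≤P zero    = spread-zero P metric-K1
spread-pow {P = P} n≥2 n≤P (suc t) =
  spread-□ (metric-K n≥2) (metric-pow n≥2 t) {P} (spread-K n≥2 n≤P) (spread-pow n≥2 n≤P t)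

spread-prodG : ∀ {P} m (ns ts : Fin m → ℕ) (ns≥2 : ∀ i → 2 ≤ ns i) (k : Fin m) →
               (∀ i → i Fin.≤ k → ns i ≤ P) → Spread P (metric-prodG m ns ts ns≥2) (psum ts k)
spread-prodG {P} (suc m) ns ts ns≥2 zero    ns≤P =
  subst (Spread P M) (+-identityʳ (ts zero))
        (spread-□ (metric-pow (ns≥2 zero) (ts zero)) Mᵣ {P}
                  (spread-pow (ns≥2 zero) (ns≤P zero z≤n) (ts zero)) (spread-zero P Mᵣ))
  where
  Mᵣ = metric-prodG m (ns ∘ suc) (ts ∘ suc) (ns≥2 ∘ suc)
  M  = metric-prodG (suc m) ns ts ns≥2
spread-prodG {P} (suc m) ns ts ns≥2 (suc k) ns≤P =
  spread-□ (metric-pow (ns≥2 zero) (ts zero)) (metric-prodG m (ns ∘ suc) (ts ∘ suc) (ns≥2 ∘ suc)) {P}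
           (spread-pow (ns≥2 zero) (ns≤P zero z≤n) (ts zero))
           (spread-prodG m (ns ∘ suc) (ts ∘ suc) (ns≥2 ∘ suc) k (λ i i≤k → ns≤P (suc i) (s≤s i≤k)))

graceful⇒spread≤pairSum-gap : ∀ {N} {G : Graph N} (M : Metric G) {P t} → P < N →
                               Spread P M t → RadioGraceful G → t ≤ pairSum (suc P) gap
graceful⇒spread≤pairSum-gap {N} {G} M {P} P<N spread (g , (_ , g-surj) , (_ , radio)) =
  ≤-trans (spread vertex) (pairSum-mono (suc P) deficiency≤gap)
  where
  instance
    N≢0 : NonZero N
    N≢0 = >-nonZero (≤-<-trans z≤n P<N)

  vertex : ℕ → Fin N
  vertex a = proj₁ (g-surj (a mod N))

  label-vertex : ∀ {a} → a < N → toℕ (g (vertex a)) ≡ a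
  label-vertex {a} a<N = begin
    toℕ (g (vertex a))  ≡⟨ cong toℕ (proj₂ (g-surj (a mod N)) refl) ⟩
    toℕ (a mod N)       ≡⟨ toℕ-fromℕ< _ ⟩
    a % N               ≡⟨ m<n⇒m%n≡m a<N ⟩
    a                   ∎
    where open ≡-Reasoning

  deficiency≤gap : ∀ a b → a < b → b < suc P → deficiency M (vertex a) (vertex b) ≤ gap a b
  deficiency≤gap a b a<b b≤P = m≤n+o⇒m∸n≤o (diam M) d (begin
    diam M      ≤⟨ s≤s⁻¹ radio-ab ⟩
    gap a b + d ≡⟨ +-comm (gap a b) d ⟩
    d + gap a b ∎)
    where
    open ≤-Reasoning
    b<N = ≤-trans b≤P P<N
    a<N = <-trans a<b b<N
    u = vertex a
    v = vertex b
    d = dist M u v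
    u≢v : u ≢ v
    u≢v u≡v = <-irrefl (trans (sym (label-vertex a<N)) (trans (cong (toℕ ∘ g) u≡v) (label-vertex b<N))) a<b
    radio-ab : suc (diam M) ≤ suc (gap a b) + d
    radio-ab = begin
      suc (diam M)                           ≡⟨ +-comm 1 (diam M) ⟩
      diam M + 1                             ≤⟨ radio (diam M) (isDiam M) u v u≢v d (isDist M u v) ⟩
      ∣ toℕ (g u) - toℕ (g v) ∣ + d          ≡⟨ cong₂ (λ x y → ∣ x - y ∣ + d) (label-vertex a<N) (label-vertex b<N) ⟩
      ∣ a - b ∣ + d                          ≡⟨ cong (_+ d) (m≤n⇒∣m-n∣≡n∸m (<⇒≤ a<b)) ⟩
      (b ∸ a) + d                            ≡⟨ cong (_+ d) (+-∸-assoc 1 a<b) ⟩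
      suc (gap a b) + d                      ∎

2≤⇒nonZero : ∀ {n} → 2 ≤ n → NonZero n
2≤⇒nonZero n≥2 = >-nonZero (<-trans z<s n≥2)

n≤n^t : ∀ n .{{_ : NonZero n}} {t} → 1 ≤ t → n ≤ n ^ t
n≤n^t n {suc t} _ = m≤m*n n (n ^ t) {{m^n≢0 n t}}

order≢0 : ∀ m (ns ts : Fin m → ℕ) → (∀ i → 2 ≤ ns i) → NonZero (order m ns ts)
order≢0 zero    ns ts ns≥2 = _
order≢0 (suc m) ns ts ns≥2 =
  m*n≢0 _ _ {{m^n≢0 (ns zero) (ts zero) {{2≤⇒nonZero (ns≥2 zero)}}}}
            {{order≢0 m (ns ∘ suc) (ts ∘ suc) (ns≥2 ∘ suc)}}

factor≤order : ∀ m (ns ts : Fin m → ℕ) → (∀ i → 2 ≤ ns i) → (∀ i → 1 ≤ ts i) →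
               ∀ k → ns k ≤ order m ns ts
factor≤order (suc m) ns ts ns≥2 ts≥1 zero = begin
  ns zero                                   ≤⟨ n≤n^t (ns zero) {{2≤⇒nonZero (ns≥2 zero)}} (ts≥1 zero) ⟩
  ns zero ^ ts zero                         ≤⟨ m≤m*n _ _ {{order≢0 m (ns ∘ suc) (ts ∘ suc) (ns≥2 ∘ suc)}} ⟩
  order (suc m) ns ts                       ∎
  where open ≤-Reasoning
factor≤order (suc m) ns ts ns≥2 ts≥1 (suc k) = begin
  ns (suc k)                                ≤⟨ factor≤order m (ns ∘ suc) (ts ∘ suc) (ns≥2 ∘ suc) (ts≥1 ∘ suc) k ⟩
  order m (ns ∘ suc) (ts ∘ suc)             ≤⟨ m≤n*m _ _ {{m^n≢0 (ns zero) (ts zero) {{2≤⇒nonZero (ns≥2 zero)}}}} ⟩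
  order (suc m) ns ts                       ∎
  where open ≤-Reasoning

-- Needed so that the labels 1, …, n_k + 1 all occur.
factor<order : ∀ m (ns ts : Fin m → ℕ) → (∀ i → 2 ≤ ns i) → (∀ i → 1 ≤ ts i) →
               ∀ k → 2 ≤ psum ts k → ns k < order m ns ts
factor<order (suc m) ns ts ns≥2 ts≥1 zero ts₀≥2 = begin-strict
  ns zero                        ≡⟨ ^-identityʳ (ns zero) ⟨
  ns zero ^ 1                    <⟨ ^-monoʳ-< (ns zero) (ns≥2 zero) ts₀≥2 ⟩
  ns zero ^ ts zero              ≤⟨ m≤m*n _ _ {{order≢0 m (ns ∘ suc) (ts ∘ suc) (ns≥2 ∘ suc)}} ⟩
  order (suc m) ns ts            ∎
  where open ≤-Reasoning
factor<order (suc m) ns ts ns≥2 ts≥1 (suc k) _ = begin-strict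
  ns (suc k)                     ≤⟨ factor≤order m (ns ∘ suc) (ts ∘ suc) (ns≥2 ∘ suc) (ts≥1 ∘ suc) k ⟩
  R                              <⟨ m<m*n R (ns zero ^ ts zero) {{order≢0 m (ns ∘ suc) (ts ∘ suc) (ns≥2 ∘ suc)}} 1<power ⟩
  R * ns zero ^ ts zero          ≡⟨ *-comm R _ ⟩
  order (suc m) ns ts            ∎
  where
  open ≤-Reasoning
  R = order m (ns ∘ suc) (ts ∘ suc)
  1<power : 1 < ns zero ^ ts zero
  1<power = ≤-trans (ns≥2 zero) (n≤n^t (ns zero) {{2≤⇒nonZero (ns≥2 zero)}} (ts≥1 zero))

theorem16 : (m : ℕ) (ns ts : Fin m → ℕ)
    → (∀ i → 2 ≤ ns i)
    → (∀ i j → i Data.Fin.< j → ns i < ns j)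
    → (∀ i → 1 ≤ ts i)
    → ∃ (λ k → 6 + ns k * (ns k * ns k ∸ 1) ≤ 6 * psum ts k)
    → ¬ RadioGraceful (prodG m ns ts)
theorem16 m ns ts ns≥2 ns-increasing ts≥1 (k , t̄ₖ-large) graceful = <-irrefl refl (begin-strict
  6 * psum ts k            ≤⟨ *-monoʳ-≤ 6 t̄ₖ≤pairSum-gap ⟩
  6 * pairSum (suc P) gap  ≡⟨ 6*pairSum-gap P ⟩
  P * (P * P ∸ 1)          <⟨ m<n+m _ z<s ⟩
  6 + P * (P * P ∸ 1)      ≤⟨ t̄ₖ-large ⟩
  6 * psum ts k            ∎)
  where
  open ≤-Reasoning
  P = ns k
  ns≤P : ∀ i → i Fin.≤ k → ns i ≤ P
  ns≤P i i≤k with m≤n⇒m<n∨m≡n i≤k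
  ... | inj₁ i<k = <⇒≤ (ns-increasing i k i<k)
  ... | inj₂ i≡k = ≤-reflexive (cong ns (toℕ-injective i≡k))
  t̄ₖ≥2 : 2 ≤ psum ts k
  t̄ₖ≥2 = *-cancelˡ-≤ 6 (≤-trans (+-monoʳ-≤ 6 (*-mono-≤ (ns≥2 k) (∸-monoˡ-≤ 1 (*-mono-≤ (ns≥2 k) (ns≥2 k))))) t̄ₖ-large)
  t̄ₖ≤pairSum-gap : psum ts k ≤ pairSum (suc P) gap
  t̄ₖ≤pairSum-gap = graceful⇒spread≤pairSum-gap (metric-prodG m ns ts ns≥2)
    (factor<order m ns ts ns≥2 ts≥1 k t̄ₖ≥2) (spread-prodG m ns ts ns≥2 k ns≤P) graceful
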